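{- Let $G\leq \mathrm{Sym}(V)$ and $H\leq \mathrm{Sym}(W)$ be transitive permutation groups on finite sets, and let $G\times H$ act on $V\times W$ by $(g,h)\colon (v,w)\mapsto (g(v),h(w))$. Then (i) $\rho(G\times H)=\rho(G)\rho(H)$, and (ii) $G\times H$ has the strict-EKR-property if and only if both $G$ and $H$ have the strict-EKR-property.
   Context: For a permutation group $K$ acting on a set $X$, a subset $I\subseteq K$ is intersecting if for all $g,h\in I$ there is $x\in X$ with $g(x)=h(x)$. For transitive $K$, the intersection density is $\rho(K)=\max |I|/|K_x|$, the maximum over intersecting sets $I$, where $K_x$ is a point stabilizer. $K$ has the strict-EKR-property if every intersecting set of maximum size in $K$ is a coset of a point stabilizer. -}

module Defs where

open import Data.Nat using (ℕ; zero; suc; _*_; _⊔_)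
open import Data.Fin using (Fin; remQuot; combine)
open import Data.Fin.Properties using () renaming (_≟_ to _≟ᶠ_)
open import Data.Vec using (Vec; lookup; tabulate; allFin)
open import Data.List using (List; []; _∷_; map; _++_; length; filter; foldr; cartesianProductWith)
import Data.List as L
open import Data.List.Relation.Unary.All using (All; all?)
open import Data.List.Relation.Unary.Any using (Any; any?)
open import Data.List.Membership.Propositional using (_∈_)
open import Data.List.Relation.Binary.Subset.Propositional using (_⊆_)
open import Data.List.Relation.Unary.Unique.Propositional using (Unique)
open import Data.Product using (Σ; ∃; _×_; _,_)
open import Data.Integer using (+_)
open import Data.Rational.Unnormalised using (ℚᵘ; mkℚᵘ; 0ℚᵘ)
open import Relation.Binary.PropositionalEquality using (_≡_)
open import Relation.Nullary using (Dec)
open import Function.Bundles using (_⇔_)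

Perm : ℕ → Set
Perm n = Vec (Fin n) n

-- σ is a bijection of Fin n (injective suffices on a finite set)
IsPerm : ∀ {n} → Perm n → Set
IsPerm {n} σ = ∀ (i j : Fin n) → lookup σ i ≡ lookup σ j → i ≡ j

idₚ : ∀ {n} → Perm n
idₚ {n} = allFin n

_∘ₚ_ : ∀ {n} → Perm n → Perm n → Perm n
σ ∘ₚ τ = tabulate (λ i → lookup σ (lookup τ i))

-- A finite permutation group K ≤ Sym(Fin n), given as the duplicate-free list of its
-- elements, containing the identity and closed under composition (for a finite set of
-- permutations this is equivalent to being a subgroup).
record IsPermGroup {n : ℕ} (K : List (Perm n)) : Set where
  field
    unique : Unique K
    perms  : All IsPerm K
    hasId  : idₚ ∈ K
    closed : ∀ {σ τ} → σ ∈ K → τ ∈ K → (σ ∘ₚ τ) ∈ K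

Transitive : ∀ {n} → List (Perm n) → Set
Transitive {n} K = ∀ (x y : Fin n) → ∃ λ σ → σ ∈ K × lookup σ x ≡ y

Agree : ∀ {n} → Perm n → Perm n → Set
Agree {n} σ τ = Any (λ x → lookup σ x ≡ lookup τ x) (Data.Vec.toList (allFin n))

agree? : ∀ {n} (σ τ : Perm n) → Dec (Agree σ τ)
agree? σ τ = any? (λ x → lookup σ x ≟ᶠ lookup τ x) _

Intersecting : ∀ {n} → List (Perm n) → Set
Intersecting I = All (λ σ → All (λ τ → Agree σ τ) I) I

intersecting? : ∀ {n} (I : List (Perm n)) → Dec (Intersecting I)
intersecting? I = all? (λ σ → all? (λ τ → agree? σ τ) I) I

-- all sub-lists (subsets, when K is duplicate-free)
subs : ∀ {A : Set} → List A → List (List A)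
subs []       = [] ∷ []
subs (x ∷ xs) = let r = subs xs in map (x ∷_) r ++ r

maxℕ : List ℕ → ℕ
maxℕ = foldr _⊔_ 0

maxIntersecting : ∀ {n} → List (Perm n) → ℕ
maxIntersecting K = maxℕ (map length (filter intersecting? (subs K)))

stabilizer : ∀ {n} → List (Perm n) → Fin n → List (Perm n)
stabilizer K x = filter (λ σ → lookup σ x ≟ᶠ x) K

-- a / b as an unnormalised rational (b = 0 never occurs for a group, since id ∈ K_x)
frac : ℕ → ℕ → ℚᵘ
frac a zero    = 0ℚᵘ
frac a (suc b) = mkℚᵘ (+ a) b

ρ : ∀ {n} → List (Perm n) → Fin n → ℚᵘ
ρ K x = frac (maxIntersecting K) (length (stabilizer K x))

IsStabCoset : ∀ {n} → List (Perm n) → List (Perm n) → Set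
IsStabCoset {n} K I =
  Σ (Perm n) λ g → g ∈ K × Σ (Fin n) λ x →
    ∀ σ → (σ ∈ I ⇔ (∃ λ τ → τ ∈ stabilizer K x × σ ≡ g ∘ₚ τ))

StrictEKR : ∀ {n} → List (Perm n) → Set
StrictEKR K = ∀ (I : List (Perm _)) → Unique I → I ⊆ K → Intersecting I →
  length I ≡ maxIntersecting K → IsStabCoset K I

-- product action on V × W, with V × W identified with Fin (m * n) via combine/remQuot
_⊗_ : ∀ {m n} → Perm m → Perm n → Perm (m * n)
_⊗_ {m} {n} g h = tabulate λ k → let (i , j) = remQuot {m} n k in combine (lookup g i) (lookup h j)

prodGroup : ∀ {m n} → List (Perm m) → List (Perm n) → List (Perm (m * n))
prodGroup G H = cartesianProductWith _⊗_ G H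

-- Two elements (g , h) and (g′ , h′) of G × H agree at some point iff g, g′ agree somewhere and
-- h, h′ agree somewhere. So products of intersecting sets are intersecting, and an intersecting
-- I ⊆ G × H lies in A × B, where A and B (its sets of first and second coordinates) are intersecting.
-- Hence the largest intersecting sets of G × H have size max(G) · max(H); together with
-- (G × H)_(v,w) = G_v × H_w this gives (i). For (ii), the same counting forces a maximum intersecting
-- I ⊆ G × H to be A × B with A, B maximum, which is the coset (g , h)(G_v × H_w) when A = g G_v and
-- B = h H_w. Conversely, if S × T is such a coset for maximum S and T, comparing coordinates gives
-- S = g G_v and T = h H_w.

module Submission where

open import Defs
open import Data.Empty using (⊥-elim)
open import Data.Fin as Fin using (Fin; combine; remQuot)
open import Data.Fin.Properties using (combine-injective; remQuot-combine; combine-remQuot)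
  renaming (_≟_ to _≟ᶠ_)
import Data.Integer as ℤ
open import Data.Integer.Properties using (pos-*)
open import Data.List using (List; []; _∷_; map; _++_; length; filter; cartesianProductWith)
open import Data.List.Properties
  using (length-++; length-map; filter-++; length-removeAt′; foldr-preservesᵇ; foldr-preservesᵒ)
open import Data.List.Membership.Propositional using (_∈_; _∉_; lose)
open import Data.List.Membership.Propositional.Properties
  using (∈-map⁺; ∈-map⁻; ∈-++⁺ˡ; ∈-++⁺ʳ; ∈-++⁻; ∈-filter⁺; ∈-filter⁻; ∈-length;
         ∈-cartesianProductWith⁺; ∈-cartesianProductWith⁻)
import Data.List.Membership.DecPropositional as DecMembership
open import Data.List.Relation.Binary.Subset.Propositional using (_⊆_)
open import Data.List.Relation.Unary.All using ([]; _∷_)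
  renaming (lookup to lookupᴬ; tabulate to tabulateᴬ)
open import Data.List.Relation.Unary.AllPairs using ([]; _∷_)
open import Data.List.Relation.Unary.Any using (here; there; satisfied; index; _─_)
open import Data.List.Relation.Unary.Unique.Propositional using (Unique)
import Data.List.Relation.Unary.Unique.Propositional.Properties as Unique
open import Data.Nat as ℕ using (ℕ; _*_; _≤_; _<_; z≤n; s≤s; NonZero; >-nonZero; ≢-nonZero⁻¹)
open import Data.Nat.Properties
  using (≤-refl; ≤-trans; ≤-reflexive; ≤-antisym; ≤⇒≯; ⊔-sel; m≤n⇒m≤n⊔o; m≤n⇒m≤o⊔n;
         *-mono-≤; *-monoˡ-≤; *-monoʳ-≤; *-cancelˡ-≤; *-cancelʳ-≤; module ≤-Reasoning)
open import Data.Product using (∃; ∃₂; _×_; _,_; proj₁; proj₂)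
open import Data.Product.Function.NonDependent.Propositional using (_×-⇔_)
open import Data.Rational.Unnormalised as ℚ using (_≃_; *≡*)
open import Data.Sum using (inj₁; inj₂; [_,_]′)
open import Data.Vec using (lookup; tabulate)
open import Data.Vec.Properties using (lookup∘tabulate; tabulate∘lookup; tabulate-cong; lookup-allFin; ≡-dec)
open import Data.Vec.Membership.Propositional.Properties using (∈-allFin⁺; ∈-toList⁺)
open import Function using (_∘_)
open import Function.Bundles using (_⇔_; mk⇔; Equivalence)
open import Function.Properties.Equivalence using () renaming (trans to ⇔-trans; sym to ⇔-sym)
open import Relation.Binary.Definitions using (DecidableEquality)
open import Relation.Binary.PropositionalEquality
open import Relation.Nullary using (yes; no; ¬_; contradiction)
open import Relation.Unary using (Decidable)

module _ {A : Set} where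

  ∈-─⁺ : ∀ {x y} {xs : List A} (x∈xs : x ∈ xs) → y ∈ xs → y ≢ x → y ∈ (xs ─ x∈xs)
  ∈-─⁺ (here refl) (here refl)  y≢x = ⊥-elim (y≢x refl)
  ∈-─⁺ (here refl) (there y∈xs) _   = y∈xs
  ∈-─⁺ (there _)   (here refl)  _   = here refl
  ∈-─⁺ (there x∈xs) (there y∈xs) y≢x = there (∈-─⁺ x∈xs y∈xs y≢x)

  unique-⊆⇒length≤ : ∀ {I J : List A} → Unique I → I ⊆ J → length I ≤ length J
  unique-⊆─⇒length< : ∀ {x} {I J : List A} (x∈J : x ∈ J) → Unique I → I ⊆ (J ─ x∈J) → length I < length J

  unique-⊆⇒length≤ {[]}    _            _    = z≤n
  unique-⊆⇒length≤ {x ∷ I} (x∉I ∷ uI) xI⊆J =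
    unique-⊆─⇒length< x∈J uI (λ y∈I → ∈-─⁺ x∈J (xI⊆J (there y∈I)) (λ y≡x → lookupᴬ x∉I y∈I (sym y≡x)))
    where x∈J = xI⊆J (here refl)

  unique-⊆─⇒length< {J = J} x∈J uI I⊆J─x =
    ≤-trans (s≤s (unique-⊆⇒length≤ uI I⊆J─x)) (≤-reflexive (sym (length-removeAt′ J (index x∈J))))

  unique-⊆-∉⇒length< : ∀ {x} {I J : List A} → Unique I → I ⊆ J → x ∈ J → x ∉ I → length I < length J
  unique-⊆-∉⇒length< uI I⊆J x∈J x∉I =
    unique-⊆─⇒length< x∈J uI (λ y∈I → ∈-─⁺ x∈J (I⊆J y∈I) λ { refl → x∉I y∈I })

  unique-⊆-length≥⇒⊇ : DecidableEquality A → ∀ {I J : List A} →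
                       Unique I → I ⊆ J → length J ≤ length I → J ⊆ I
  unique-⊆-length≥⇒⊇ _≟_ {I} uI I⊆J J≤I {x} x∈J with x ∈? I
    where open DecMembership _≟_ using (_∈?_)
  ... | yes x∈I = x∈I
  ... | no  x∉I = contradiction (unique-⊆-∉⇒length< uI I⊆J x∈J x∉I) (≤⇒≯ J≤I)

  filter∈subs : ∀ {P : A → Set} (P? : Decidable P) xs → filter P? xs ∈ subs xs
  filter∈subs P? []       = here refl
  filter∈subs P? (x ∷ xs) with P? x
  ... | yes _ = ∈-++⁺ˡ (∈-map⁺ (x ∷_) (filter∈subs P? xs))
  ... | no  _ = ∈-++⁺ʳ (map (x ∷_) (subs xs)) (filter∈subs P? xs)

  ∈-subs⇒⊆ : ∀ xs {ys : List A} → ys ∈ subs xs → ys ⊆ xs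
  ∈-subs⇒⊆ []       (here refl) ()
  ∈-subs⇒⊆ (x ∷ xs) ys∈ y∈ys with ∈-++⁻ (map (x ∷_) (subs xs)) ys∈
  ... | inj₂ ys∈′ = there (∈-subs⇒⊆ xs ys∈′ y∈ys)
  ... | inj₁ x∷ys∈ with ∈-map⁻ (x ∷_) x∷ys∈
  ...   | _ , ys∈′ , refl with y∈ys
  ...     | here y≡x    = here y≡x
  ...     | there y∈ys′ = there (∈-subs⇒⊆ xs ys∈′ y∈ys′)

  ∈-subs⇒unique : ∀ {xs ys : List A} → Unique xs → ys ∈ subs xs → Unique ys
  ∈-subs⇒unique {[]}     _            (here refl) = []
  ∈-subs⇒unique {x ∷ xs} (x∉xs ∷ uxs) ys∈ with ∈-++⁻ (map (x ∷_) (subs xs)) ys∈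
  ... | inj₂ ys∈′ = ∈-subs⇒unique uxs ys∈′
  ... | inj₁ x∷ys∈ with ∈-map⁻ (x ∷_) x∷ys∈
  ...   | _ , ys∈′ , refl = tabulateᴬ (λ y∈ → lookupᴬ x∉xs (∈-subs⇒⊆ xs ys∈′ y∈)) ∷ ∈-subs⇒unique uxs ys∈′

module _ {A B C : Set} (f : A → B → C) where

  length-cartesianProductWith : ∀ xs ys →
    length (cartesianProductWith f xs ys) ≡ length xs * length ys
  length-cartesianProductWith []       ys = refl
  length-cartesianProductWith (x ∷ xs) ys = trans (length-++ (map (f x) ys))
    (cong₂ ℕ._+_ (length-map (f x) ys) (length-cartesianProductWith xs ys))

  module _ {P : C → Set} {Q : A → Set} {R : B → Set}
           (P? : Decidable P) (Q? : Decidable Q) (R? : Decidable R)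
           (P⇔Q×R : ∀ a b → P (f a b) ⇔ (Q a × R b)) where

    filter-map-accepted : ∀ {a} → Q a → ∀ ys → filter P? (map (f a) ys) ≡ map (f a) (filter R? ys)
    filter-map-accepted qa []       = refl
    filter-map-accepted {a} qa (y ∷ ys) with P? (f a y) | R? y
    ... | yes _   | yes _  = cong (f a y ∷_) (filter-map-accepted qa ys)
    ... | no  _   | no  _  = filter-map-accepted qa ys
    ... | yes pay | no ¬ry = contradiction (proj₂ (Equivalence.to (P⇔Q×R a y) pay)) ¬ry
    ... | no ¬pay | yes ry = contradiction (Equivalence.from (P⇔Q×R a y) (qa , ry)) ¬pay

    filter-map-rejected : ∀ {a} → ¬ Q a → ∀ ys → filter P? (map (f a) ys) ≡ []
    filter-map-rejected ¬qa []       = refl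
    filter-map-rejected {a} ¬qa (y ∷ ys) with P? (f a y)
    ... | yes pay = contradiction (proj₁ (Equivalence.to (P⇔Q×R a y) pay)) ¬qa
    ... | no  _   = filter-map-rejected ¬qa ys

    filter-cartesianProductWith : ∀ xs ys →
      filter P? (cartesianProductWith f xs ys) ≡ cartesianProductWith f (filter Q? xs) (filter R? ys)
    filter-cartesianProductWith []       ys = refl
    filter-cartesianProductWith (x ∷ xs) ys with Q? x
    ... | yes qx = begin
      filter P? (map (f x) ys ++ cartesianProductWith f xs ys)             ≡⟨ filter-++ P? (map (f x) ys) _ ⟩
      filter P? (map (f x) ys) ++ filter P? (cartesianProductWith f xs ys)
        ≡⟨ cong₂ _++_ (filter-map-accepted qx ys) (filter-cartesianProductWith xs ys) ⟩
      map (f x) (filter R? ys) ++ cartesianProductWith f (filter Q? xs) (filter R? ys) ∎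
      where open ≡-Reasoning
    ... | no ¬qx = begin
      filter P? (map (f x) ys ++ cartesianProductWith f xs ys)             ≡⟨ filter-++ P? (map (f x) ys) _ ⟩
      filter P? (map (f x) ys) ++ filter P? (cartesianProductWith f xs ys)
        ≡⟨ cong₂ _++_ (filter-map-rejected ¬qx ys) (filter-cartesianProductWith xs ys) ⟩
      cartesianProductWith f (filter Q? xs) (filter R? ys)                 ∎
      where open ≡-Reasoning

≤maxℕ : ∀ {x xs} → x ∈ xs → x ≤ maxℕ xs
≤maxℕ {x} x∈xs = foldr-preservesᵒ
  (λ a b → [ m≤n⇒m≤n⊔o b , m≤n⇒m≤o⊔n a ]′) 0 _ (inj₂ (lose x∈xs ≤-refl))

maxℕ∈ : ∀ xs → maxℕ xs ∈ 0 ∷ xs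
maxℕ∈ xs = foldr-preservesᵇ
  (λ {a} {b} a∈ b∈ → [ (λ a⊔b≡a → subst (_∈ 0 ∷ xs) (sym a⊔b≡a) a∈)
                     , (λ a⊔b≡b → subst (_∈ 0 ∷ xs) (sym a⊔b≡b) b∈) ]′ (⊔-sel a b))
  (here refl) (tabulateᴬ there)

*-mono-≤-tight : ∀ {a b c d} .{{_ : NonZero c}} .{{_ : NonZero d}} →
                 a ≤ c → b ≤ d → c * d ≤ a * b → a ≡ c × b ≡ d
*-mono-≤-tight {a} {b} {c} {d} a≤c b≤d cd≤ab =
  ≤-antisym a≤c (*-cancelʳ-≤ c a d (≤-trans cd≤ab (*-monoʳ-≤ a b≤d))) ,
  ≤-antisym b≤d (*-cancelˡ-≤ c (≤-trans cd≤ab (*-monoˡ-≤ b a≤c)))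

_≟ₚ_ : ∀ {n} → DecidableEquality (Perm n)
_≟ₚ_ = ≡-dec _≟ᶠ_

perm-ext : ∀ {n} {σ τ : Perm n} → (∀ i → lookup σ i ≡ lookup τ i) → σ ≡ τ
perm-ext {σ = σ} {τ} σ≗τ = begin
  σ                  ≡⟨ tabulate∘lookup σ ⟨
  tabulate (lookup σ) ≡⟨ tabulate-cong σ≗τ ⟩
  tabulate (lookup τ) ≡⟨ tabulate∘lookup τ ⟩
  τ                  ∎
  where open ≡-Reasoning

lookup-∘ₚ : ∀ {n} (σ τ : Perm n) i → lookup (σ ∘ₚ τ) i ≡ lookup σ (lookup τ i)
lookup-∘ₚ σ τ = lookup∘tabulate _

∘ₚ-identityʳ : ∀ {n} (σ : Perm n) → σ ∘ₚ idₚ ≡ σ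
∘ₚ-identityʳ σ = perm-ext λ i → trans (lookup-∘ₚ σ idₚ i) (cong (lookup σ) (lookup-allFin i))

agree : ∀ {n} {σ τ : Perm n} (x : Fin n) → lookup σ x ≡ lookup τ x → Agree σ τ
agree x = lose (∈-toList⁺ (∈-allFin⁺ x))

module _ {n : ℕ} where

  intersecting⁺ : {I : List (Perm n)} → (∀ {σ τ} → σ ∈ I → τ ∈ I → Agree σ τ) → Intersecting I
  intersecting⁺ agrees = tabulateᴬ λ σ∈I → tabulateᴬ λ τ∈I → agrees σ∈I τ∈I

  intersecting⁻ : {I : List (Perm n)} → Intersecting I → ∀ {σ τ} → σ ∈ I → τ ∈ I → Agree σ τ
  intersecting⁻ intI σ∈I τ∈I = lookupᴬ (lookupᴬ intI σ∈I) τ∈I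

  record IntersectingIn (K I : List (Perm n)) : Set where
    field
      unique       : Unique I
      ⊆K           : I ⊆ K
      intersecting : Intersecting I

  MaxIntersecting : List (Perm n) → List (Perm n) → Set
  MaxIntersecting K I = IntersectingIn K I × length I ≡ maxIntersecting K

  []-intersectingIn : ∀ {K} → IntersectingIn K []
  []-intersectingIn = record { unique = [] ; ⊆K = λ () ; intersecting = [] }

  strictEKR⁺ : ∀ {K} → (∀ {I} → MaxIntersecting K I → IsStabCoset K I) → StrictEKR K
  strictEKR⁺ cosets I I-unique I⊆K I-intersecting ∣I∣≡max =
    cosets (record { unique = I-unique ; ⊆K = I⊆K ; intersecting = I-intersecting } , ∣I∣≡max)

  strictEKR⁻ : ∀ {K I} → StrictEKR K → MaxIntersecting K I → IsStabCoset K I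
  strictEKR⁻ ekr (I-int , ∣I∣≡max) = ekr _ unique ⊆K intersecting ∣I∣≡max
    where open IntersectingIn I-int

  intersectingIn⇒length≤ : ∀ {K I} → IntersectingIn K I → length I ≤ maxIntersecting K
  intersectingIn⇒length≤ {K} {I} I-int = ≤-trans
      (unique-⊆⇒length≤ unique (λ σ∈I → ∈-filter⁺ (_∈? I) (⊆K σ∈I) σ∈I))
      (≤maxℕ (∈-map⁺ length (∈-filter⁺ intersecting? (filter∈subs (_∈? I) K) K∩I-intersecting)))
    where
    open IntersectingIn I-int
    open DecMembership (_≟ₚ_ {n}) using (_∈?_)
    K∩I-intersecting : Intersecting (filter (_∈? I) K)
    K∩I-intersecting = intersecting⁺ λ σ∈ τ∈ →
      intersecting⁻ intersecting (proj₂ (∈-filter⁻ (_∈? I) {xs = K} σ∈)) (proj₂ (∈-filter⁻ (_∈? I) {xs = K} τ∈))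

  maxIntersecting-attained : ∀ {K} → Unique K → ∃ (MaxIntersecting K)
  maxIntersecting-attained {K} uK with maxℕ∈ (map length (filter intersecting? (subs K)))
  ... | here max≡0 = [] , []-intersectingIn , sym max≡0
  ... | there max∈ with ∈-map⁻ length max∈
  ...   | J , J∈ , max≡∣J∣ with ∈-filter⁻ intersecting? J∈
  ...     | J∈subs , intJ =
    J , record { unique = ∈-subs⇒unique uK J∈subs ; ⊆K = ∈-subs⇒⊆ K J∈subs ; intersecting = intJ }
      , sym max≡∣J∣

  module _ {K : List (Perm n)} (K-group : IsPermGroup K) (x : Fin n) where
    open IsPermGroup K-group

    idₚ∈stabilizer : idₚ ∈ stabilizer K x
    idₚ∈stabilizer = ∈-filter⁺ (λ σ → lookup σ x ≟ᶠ x) hasId (lookup-allFin x)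

    stabilizer-nonZero : NonZero (length (stabilizer K x))
    stabilizer-nonZero = >-nonZero (∈-length idₚ∈stabilizer)

    maxIntersecting-nonZero : NonZero (maxIntersecting K)
    maxIntersecting-nonZero = >-nonZero (intersectingIn⇒length≤ {K} {idₚ ∷ []} record
      { unique       = [] ∷ []
      ; ⊆K           = λ { (here refl) → hasId }
      ; intersecting = (agree {σ = idₚ} {idₚ} x refl ∷ []) ∷ []
      })

    maxIntersecting-inhabited : ∀ {I} → MaxIntersecting K I → ∃ (_∈ I)
    maxIntersecting-inhabited {σ ∷ _} _ = σ , here refl
    maxIntersecting-inhabited {[]}    (_ , 0≡max) = contradiction (sym 0≡max) (≢-nonZero⁻¹ _)
      where instance _ = maxIntersecting-nonZero

-- For n = 0 no two permutations agree, so [] is a maximum intersecting set; strict-EKR then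
-- presents it as a coset of the stabilizer of a point.
strictEKR-point : ∀ {n} {K : List (Perm n)} → StrictEKR K → Fin n
strictEKR-point {ℕ.suc n} _   = Fin.zero
strictEKR-point {ℕ.zero} {K} ekr =
  proj₁ (proj₂ (proj₂ (strictEKR⁻ ekr ([]-intersectingIn , sym nothing-intersects))))
  where
  nothing-intersects : maxIntersecting K ≡ 0
  nothing-intersects with maxℕ∈ (map length (filter intersecting? (subs K)))
  ... | here max≡0 = max≡0
  ... | there max∈ with ∈-map⁻ length max∈
  ...   | []    , _  , max≡0 = max≡0
  ...   | _ ∷ _ , J∈ , _
    with () ← intersecting⁻ (proj₂ (∈-filter⁻ intersecting? {xs = subs K} J∈)) (here refl) (here refl)

module _ {m n : ℕ} where

  lookup-⊗-remQuot : (g : Perm m) (h : Perm n) (k : Fin (m * n)) →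
                     let (i , j) = remQuot {m} n k in lookup (g ⊗ h) k ≡ combine (lookup g i) (lookup h j)
  lookup-⊗-remQuot g h = lookup∘tabulate _

  lookup-⊗ : (g : Perm m) (h : Perm n) (i : Fin m) (j : Fin n) →
             lookup (g ⊗ h) (combine i j) ≡ combine (lookup g i) (lookup h j)
  lookup-⊗ g h i j = trans (lookup-⊗-remQuot g h (combine i j))
    (cong (λ (i′ , j′) → combine (lookup g i′) (lookup h j′)) (remQuot-combine i j))

  combine-ext : {σ τ : Perm (m * n)} →
                (∀ (i : Fin m) (j : Fin n) → lookup σ (combine i j) ≡ lookup τ (combine i j)) → σ ≡ τ
  combine-ext {σ} {τ} σ≗τ = perm-ext {σ = σ} {τ} λ k →
    subst (λ k → lookup σ k ≡ lookup τ k) (combine-remQuot {m} n k) (σ≗τ _ _)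

  ⊗-∘ₚ : (g g′ : Perm m) (h h′ : Perm n) → (g ⊗ h) ∘ₚ (g′ ⊗ h′) ≡ (g ∘ₚ g′) ⊗ (h ∘ₚ h′)
  ⊗-∘ₚ g g′ h h′ = combine-ext λ i j → begin
    lookup ((g ⊗ h) ∘ₚ (g′ ⊗ h′)) (combine i j)               ≡⟨ lookup-∘ₚ (g ⊗ h) (g′ ⊗ h′) _ ⟩
    lookup (g ⊗ h) (lookup (g′ ⊗ h′) (combine i j))            ≡⟨ cong (lookup (g ⊗ h)) (lookup-⊗ g′ h′ i j) ⟩
    lookup (g ⊗ h) (combine (lookup g′ i) (lookup h′ j))       ≡⟨ lookup-⊗ g h _ _ ⟩
    combine (lookup g (lookup g′ i)) (lookup h (lookup h′ j))
      ≡⟨ cong₂ combine (lookup-∘ₚ g g′ i) (lookup-∘ₚ h h′ j) ⟨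
    combine (lookup (g ∘ₚ g′) i) (lookup (h ∘ₚ h′) j)          ≡⟨ lookup-⊗ (g ∘ₚ g′) (h ∘ₚ h′) i j ⟨
    lookup ((g ∘ₚ g′) ⊗ (h ∘ₚ h′)) (combine i j)              ∎
    where open ≡-Reasoning

  projˡ : Fin n → Perm (m * n) → Perm m
  projˡ j σ = tabulate λ i → proj₁ (remQuot {m} n (lookup σ (combine i j)))

  projʳ : Fin m → Perm (m * n) → Perm n
  projʳ i σ = tabulate λ j → proj₂ (remQuot {m} n (lookup σ (combine i j)))

  projˡ-⊗ : (j : Fin n) (g : Perm m) (h : Perm n) → projˡ j (g ⊗ h) ≡ g
  projˡ-⊗ j g h = perm-ext λ i → begin
    lookup (projˡ j (g ⊗ h)) i                                 ≡⟨ lookup∘tabulate _ i ⟩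
    proj₁ (remQuot {m} n (lookup (g ⊗ h) (combine i j)))        ≡⟨ cong (proj₁ ∘ remQuot {m} n) (lookup-⊗ g h i j) ⟩
    proj₁ (remQuot {m} n (combine (lookup g i) (lookup h j)))  ≡⟨ cong proj₁ (remQuot-combine (lookup g i) (lookup h j)) ⟩
    lookup g i                                                 ∎
    where open ≡-Reasoning

  projʳ-⊗ : (i : Fin m) (g : Perm m) (h : Perm n) → projʳ i (g ⊗ h) ≡ h
  projʳ-⊗ i g h = perm-ext λ j → begin
    lookup (projʳ i (g ⊗ h)) j                                 ≡⟨ lookup∘tabulate _ j ⟩
    proj₂ (remQuot {m} n (lookup (g ⊗ h) (combine i j)))        ≡⟨ cong (proj₂ ∘ remQuot {m} n) (lookup-⊗ g h i j) ⟩
    proj₂ (remQuot {m} n (combine (lookup g i) (lookup h j)))  ≡⟨ cong proj₂ (remQuot-combine (lookup g i) (lookup h j)) ⟩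
    lookup h j                                                 ∎
    where open ≡-Reasoning

  -- The points matter: for n = 0 every g ⊗ h is the empty permutation.
  ⊗-injective : Fin m → Fin n → ∀ {g g′ h h′} → g ⊗ h ≡ g′ ⊗ h′ → g ≡ g′ × h ≡ h′
  ⊗-injective i j {g} {g′} {h} {h′} gh≡g′h′ =
    trans (sym (projˡ-⊗ j g h)) (trans (cong (projˡ j) gh≡g′h′) (projˡ-⊗ j g′ h′)) ,
    trans (sym (projʳ-⊗ i g h)) (trans (cong (projʳ i) gh≡g′h′) (projʳ-⊗ i g′ h′))

  agree-⊗ : (g g′ : Perm m) (h h′ : Perm n) → Agree (g ⊗ h) (g′ ⊗ h′) ⇔ (Agree g g′ × Agree h h′)
  agree-⊗ g g′ h h′ = mk⇔ to from
    where
    to : Agree (g ⊗ h) (g′ ⊗ h′) → Agree g g′ × Agree h h′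
    to agrees with k , gh≡g′h′ ← satisfied agrees
      with gk≡g′k , hk≡h′k ← combine-injective _ _ _ _
             (trans (sym (lookup-⊗-remQuot g h k)) (trans gh≡g′h′ (lookup-⊗-remQuot g′ h′ k)))
      = agree {σ = g} {g′} _ gk≡g′k , agree {σ = h} {h′} _ hk≡h′k
    from : Agree g g′ × Agree h h′ → Agree (g ⊗ h) (g′ ⊗ h′)
    from (agree-g , agree-h) with i , gi≡g′i ← satisfied agree-g | j , hj≡h′j ← satisfied agree-h
      = agree {σ = g ⊗ h} {g′ ⊗ h′} (combine i j)
          (trans (lookup-⊗ g h i j) (trans (cong₂ combine gi≡g′i hj≡h′j) (sym (lookup-⊗ g′ h′ i j))))

  ⊗-fixes : (g : Perm m) (h : Perm n) (v : Fin m) (w : Fin n) →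
            lookup (g ⊗ h) (combine v w) ≡ combine v w ⇔ (lookup g v ≡ v × lookup h w ≡ w)
  ⊗-fixes g h v w = mk⇔
    (λ fixes → combine-injective _ _ _ _ (trans (sym (lookup-⊗ g h v w)) fixes))
    (λ (gv≡v , hw≡w) → trans (lookup-⊗ g h v w) (cong₂ combine gv≡v hw≡w))

module _ {m n : ℕ} where

  ⊗-∈-prodGroup : Fin m → Fin n → ∀ {S T a b} → a ⊗ b ∈ prodGroup S T ⇔ (a ∈ S × b ∈ T)
  ⊗-∈-prodGroup i j {S} {T} = mk⇔ to λ (a∈S , b∈T) → ∈-cartesianProductWith⁺ _⊗_ a∈S b∈T
    where
    to : ∀ {a b} → a ⊗ b ∈ prodGroup S T → a ∈ S × b ∈ T
    to {a} {b} ab∈ with a′ , b′ , a′∈S , b′∈T , ab≡a′b′ ← ∈-cartesianProductWith⁻ _⊗_ S T ab∈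
                   with refl , refl ← ⊗-injective i j {a} {a′} {b} {b′} ab≡a′b′ = a′∈S , b′∈T

  prodGroup-intersecting : {S : List (Perm m)} {T : List (Perm n)} →
                           Intersecting S → Intersecting T → Intersecting (prodGroup S T)
  prodGroup-intersecting {S} {T} intS intT = intersecting⁺ λ σ∈ τ∈ →
    agrees (∈-cartesianProductWith⁻ _⊗_ S T σ∈) (∈-cartesianProductWith⁻ _⊗_ S T τ∈)
    where
    agrees : ∀ {σ τ} → (∃₂ λ a b → a ∈ S × b ∈ T × σ ≡ a ⊗ b) →
             (∃₂ λ a b → a ∈ S × b ∈ T × τ ≡ a ⊗ b) → Agree σ τ
    agrees (a , b , a∈ , b∈ , refl) (a′ , b′ , a′∈ , b′∈ , refl) =
      Equivalence.from (agree-⊗ a a′ b b′) (intersecting⁻ intS a∈ a′∈ , intersecting⁻ intT b∈ b′∈)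

  prodGroup-unique : Fin m → Fin n → {S : List (Perm m)} {T : List (Perm n)} →
                     Unique S → Unique T → Unique (prodGroup S T)
  prodGroup-unique i j = Unique.cartesianProductWith⁺ _⊗_ (⊗-injective i j)

  prodGroup-intersectingIn : Fin m → Fin n →
    ∀ {G S : List (Perm m)} {H T : List (Perm n)} →
    IntersectingIn G S → IntersectingIn H T → IntersectingIn (prodGroup G H) (prodGroup S T)
  prodGroup-intersectingIn i j {G} {S} {H} {T} S-int T-int = record
    { unique       = prodGroup-unique i j (unique S-int) (unique T-int)
    ; ⊆K           = S⊠T⊆G⊠H
    ; intersecting = prodGroup-intersecting (intersecting S-int) (intersecting T-int)
    }
    where
    open IntersectingIn
    S⊠T⊆G⊠H : prodGroup S T ⊆ prodGroup G H
    S⊠T⊆G⊠H σ∈ with _ , _ , a∈S , b∈T , refl ← ∈-cartesianProductWith⁻ _⊗_ S T σ∈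
      = ∈-cartesianProductWith⁺ _⊗_ (⊆K S-int a∈S) (⊆K T-int b∈T)

  stabilizer-prodGroup : (G : List (Perm m)) (H : List (Perm n)) (v : Fin m) (w : Fin n) →
    stabilizer (prodGroup G H) (combine v w) ≡ prodGroup (stabilizer G v) (stabilizer H w)
  stabilizer-prodGroup G H v w = filter-cartesianProductWith _⊗_ _ _ _ (λ g h → ⊗-fixes g h v w) G H

  module Factors {G : List (Perm m)} {H : List (Perm n)} (G-unique : Unique G) (H-unique : Unique H)
                 (v : Fin m) (w : Fin n) {I : List (Perm (m * n))} (I-int : IntersectingIn (prodGroup G H) I)
                 where
    open IntersectingIn I-int
    open DecMembership (_≟ₚ_ {m}) using () renaming (_∈?_ to _∈?ˡ_)
    open DecMembership (_≟ₚ_ {n}) using () renaming (_∈?_ to _∈?ʳ_)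

    left : List (Perm m)
    left = filter (_∈?ˡ map (projˡ w) I) G

    right : List (Perm n)
    right = filter (_∈?ʳ map (projʳ v) I) H

    ⊆left⊠right : I ⊆ prodGroup left right
    ⊆left⊠right σ∈I with a , b , a∈G , b∈H , refl ← ∈-cartesianProductWith⁻ _⊗_ G H (⊆K σ∈I) =
      ∈-cartesianProductWith⁺ _⊗_
        (∈-filter⁺ (_∈?ˡ map (projˡ w) I) a∈G (subst (_∈ map (projˡ w) I) (projˡ-⊗ w a b) (∈-map⁺ (projˡ w) σ∈I)))
        (∈-filter⁺ (_∈?ʳ map (projʳ v) I) b∈H (subst (_∈ map (projʳ v) I) (projʳ-⊗ v a b) (∈-map⁺ (projʳ v) σ∈I)))

    factors-agree : ∀ {σ τ} → σ ∈ I → τ ∈ I →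
                    Agree (projˡ w σ) (projˡ w τ) × Agree (projʳ v σ) (projʳ v τ)
    factors-agree σ∈I τ∈I
      with a , b , _ , _ , refl ← ∈-cartesianProductWith⁻ _⊗_ G H (⊆K σ∈I)
         | a′ , b′ , _ , _ , refl ← ∈-cartesianProductWith⁻ _⊗_ G H (⊆K τ∈I)
      with agree-a , agree-b ← Equivalence.to (agree-⊗ a a′ b b′) (intersecting⁻ intersecting σ∈I τ∈I)
      = subst₂ Agree (sym (projˡ-⊗ w a b)) (sym (projˡ-⊗ w a′ b′)) agree-a
      , subst₂ Agree (sym (projʳ-⊗ v a b)) (sym (projʳ-⊗ v a′ b′)) agree-b

    left-intersectingIn : IntersectingIn G left
    left-intersectingIn = record
      { unique       = Unique.filter⁺ _ G-unique
      ; ⊆K           = λ a∈ → proj₁ (∈-filter⁻ (_∈?ˡ map (projˡ w) I) {xs = G} a∈)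
      ; intersecting = intersecting⁺ λ a∈ a′∈ →
                         agrees (proj₂ (∈-filter⁻ _ {xs = G} a∈)) (proj₂ (∈-filter⁻ _ {xs = G} a′∈))
      }
      where
      agrees : ∀ {a a′} → a ∈ map (projˡ w) I → a′ ∈ map (projˡ w) I → Agree a a′
      agrees a∈ a′∈ with _ , σ∈I , refl ← ∈-map⁻ (projˡ w) a∈ | _ , τ∈I , refl ← ∈-map⁻ (projˡ w) a′∈
        = proj₁ (factors-agree σ∈I τ∈I)

    right-intersectingIn : IntersectingIn H right
    right-intersectingIn = record
      { unique       = Unique.filter⁺ _ H-unique
      ; ⊆K           = λ b∈ → proj₁ (∈-filter⁻ (_∈?ʳ map (projʳ v) I) {xs = H} b∈)
      ; intersecting = intersecting⁺ λ b∈ b′∈ →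
                         agrees (proj₂ (∈-filter⁻ _ {xs = H} b∈)) (proj₂ (∈-filter⁻ _ {xs = H} b′∈))
      }
      where
      agrees : ∀ {b b′} → b ∈ map (projʳ v) I → b′ ∈ map (projʳ v) I → Agree b b′
      agrees b∈ b′∈ with _ , σ∈I , refl ← ∈-map⁻ (projʳ v) b∈ | _ , τ∈I , refl ← ∈-map⁻ (projʳ v) b′∈
        = proj₂ (factors-agree σ∈I τ∈I)

    length≤left*right : length I ≤ length left * length right
    length≤left*right = ≤-trans (unique-⊆⇒length≤ unique ⊆left⊠right)
      (≤-reflexive (length-cartesianProductWith _⊗_ left right))

  module _ {G : List (Perm m)} {H : List (Perm n)} (G-group : IsPermGroup G) (H-group : IsPermGroup H)
           (v : Fin m) (w : Fin n) where
    open IsPermGroup using (unique)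

    maxIntersecting-prodGroup :
      maxIntersecting (prodGroup G H) ≡ maxIntersecting G * maxIntersecting H
    maxIntersecting-prodGroup = ≤-antisym ≤-product ≥-product
      where
      open ≤-Reasoning
      ≤-product : maxIntersecting (prodGroup G H) ≤ maxIntersecting G * maxIntersecting H
      ≤-product with I , I-int , ∣I∣≡max ←
                      maxIntersecting-attained (prodGroup-unique v w (unique G-group) (unique H-group)) = begin
        maxIntersecting (prodGroup G H) ≡⟨ ∣I∣≡max ⟨
        length I                        ≤⟨ length≤left*right ⟩
        length left * length right
          ≤⟨ *-mono-≤ (intersectingIn⇒length≤ left-intersectingIn) (intersectingIn⇒length≤ right-intersectingIn) ⟩
        maxIntersecting G * maxIntersecting H ∎
        where open Factors (unique G-group) (unique H-group) v w I-int
      ≥-product : maxIntersecting G * maxIntersecting H ≤ maxIntersecting (prodGroup G H)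
      ≥-product with S , S-int , ∣S∣≡max ← maxIntersecting-attained (unique G-group)
                   | T , T-int , ∣T∣≡max ← maxIntersecting-attained (unique H-group) = begin
        maxIntersecting G * maxIntersecting H ≡⟨ cong₂ _*_ ∣S∣≡max ∣T∣≡max ⟨
        length S * length T                   ≡⟨ length-cartesianProductWith _⊗_ S T ⟨
        length (prodGroup S T)                ≤⟨ intersectingIn⇒length≤ (prodGroup-intersectingIn v w S-int T-int) ⟩
        maxIntersecting (prodGroup G H)       ∎

    prodGroup-maxIntersecting : ∀ {S T} → MaxIntersecting G S → MaxIntersecting H T →
                                MaxIntersecting (prodGroup G H) (prodGroup S T)
    prodGroup-maxIntersecting {S} {T} (S-int , ∣S∣≡max) (T-int , ∣T∣≡max) =
      prodGroup-intersectingIn v w S-int T-int , (begin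
        length (prodGroup S T)                ≡⟨ length-cartesianProductWith _⊗_ S T ⟩
        length S * length T                   ≡⟨ cong₂ _*_ ∣S∣≡max ∣T∣≡max ⟩
        maxIntersecting G * maxIntersecting H ≡⟨ maxIntersecting-prodGroup ⟨
        maxIntersecting (prodGroup G H)       ∎)
      where open ≡-Reasoning

    maxIntersecting-factors : ∀ {I} → MaxIntersecting (prodGroup G H) I →
      ∃₂ λ (S : List (Perm m)) (T : List (Perm n)) →
        MaxIntersecting G S × MaxIntersecting H T × I ⊆ prodGroup S T × prodGroup S T ⊆ I
    maxIntersecting-factors {I} (I-int , ∣I∣≡max) =
      left , right , (left-intersectingIn , ∣left∣≡max) , (right-intersectingIn , ∣right∣≡max) ,
      ⊆left⊠right , left⊠right⊆I
      where
      open Factors (unique G-group) (unique H-group) v w I-int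
      open ≤-Reasoning
      instance
        _ = maxIntersecting-nonZero G-group v
        _ = maxIntersecting-nonZero H-group w
      ∣left∣≡max×∣right∣≡max : length left ≡ maxIntersecting G × length right ≡ maxIntersecting H
      ∣left∣≡max×∣right∣≡max = *-mono-≤-tight
        (intersectingIn⇒length≤ left-intersectingIn) (intersectingIn⇒length≤ right-intersectingIn) (begin
          maxIntersecting G * maxIntersecting H ≡⟨ maxIntersecting-prodGroup ⟨
          maxIntersecting (prodGroup G H)       ≡⟨ ∣I∣≡max ⟨
          length I                              ≤⟨ length≤left*right ⟩
          length left * length right            ∎)
      ∣left∣≡max = proj₁ ∣left∣≡max×∣right∣≡max
      ∣right∣≡max = proj₂ ∣left∣≡max×∣right∣≡max
      left⊠right⊆I : prodGroup left right ⊆ I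
      left⊠right⊆I = unique-⊆-length≥⇒⊇ _≟ₚ_ (IntersectingIn.unique I-int) ⊆left⊠right (begin
        length (prodGroup left right)         ≡⟨ length-cartesianProductWith _⊗_ left right ⟩
        length left * length right            ≡⟨ cong₂ _*_ ∣left∣≡max ∣right∣≡max ⟩
        maxIntersecting G * maxIntersecting H ≡⟨ maxIntersecting-prodGroup ⟨
        maxIntersecting (prodGroup G H)       ≡⟨ ∣I∣≡max ⟨
        length I                              ∎)

InStabCoset : ∀ {n} → List (Perm n) → Perm n → Fin n → Perm n → Set
InStabCoset K g x σ = ∃ λ τ → τ ∈ stabilizer K x × σ ≡ g ∘ₚ τ

inStabCoset-self : ∀ {n} {K : List (Perm n)} → IsPermGroup K → ∀ g x → InStabCoset K g x g
inStabCoset-self K-group g x = idₚ , idₚ∈stabilizer K-group x , sym (∘ₚ-identityʳ g)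

isStabCoset-resp : ∀ {n} {K I J : List (Perm n)} → I ⊆ J → J ⊆ I → IsStabCoset K I → IsStabCoset K J
isStabCoset-resp I⊆J J⊆I (g , g∈K , x , I≐coset) = g , g∈K , x , λ σ → mk⇔
  (λ σ∈J → Equivalence.to (I≐coset σ) (J⊆I σ∈J))
  (λ σ∈coset → I⊆J (Equivalence.from (I≐coset σ) σ∈coset))

module _ {X Y : Set} {A C : X → Set} {B D : Y → Set}
         (A×B⇔C×D : ∀ x y → (A x × B y) ⇔ (C x × D y)) where

  ×-⇔-factorˡ : ∃ B → ∃ D → ∀ x → A x ⇔ C x
  ×-⇔-factorˡ (y , By) (y′ , Dy′) x = mk⇔
    (λ Ax → proj₁ (Equivalence.to (A×B⇔C×D x y) (Ax , By)))
    (λ Cx → proj₁ (Equivalence.from (A×B⇔C×D x y′) (Cx , Dy′)))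

  ×-⇔-factorʳ : ∃ A → ∃ C → ∀ y → B y ⇔ D y
  ×-⇔-factorʳ (x , Ax) (x′ , Cx′) y = mk⇔
    (λ By → proj₂ (Equivalence.to (A×B⇔C×D x y) (Ax , By)))
    (λ Dy → proj₂ (Equivalence.from (A×B⇔C×D x′ y) (Cx′ , Dy)))

module _ {m n : ℕ} where

  IsProduct : Perm (m * n) → Set
  IsProduct σ = ∃₂ λ (a : Perm m) (b : Perm n) → σ ≡ a ⊗ b

  ⇔-on-products : {P Q : Perm (m * n) → Set} →
                  (∀ {σ} → P σ → IsProduct σ) → (∀ {σ} → Q σ → IsProduct σ) →
                  (∀ (a : Perm m) (b : Perm n) → P (a ⊗ b) ⇔ Q (a ⊗ b)) → ∀ σ → P σ ⇔ Q σ
  ⇔-on-products P⇒product Q⇒product P⇔Q σ = mk⇔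
    (λ Pσ → on-product (P⇒product Pσ) (λ a b → Equivalence.to (P⇔Q a b)) Pσ)
    (λ Qσ → on-product (Q⇒product Qσ) (λ a b → Equivalence.from (P⇔Q a b)) Qσ)
    where
    on-product : ∀ {R S : Perm (m * n) → Set} {σ} → IsProduct σ →
                 (∀ (a : Perm m) (b : Perm n) → R (a ⊗ b) → S (a ⊗ b)) → R σ → S σ
    on-product (a , b , refl) R⇒S = R⇒S a b

  ∈-prodGroup⇒isProduct : ∀ {S T σ} → σ ∈ prodGroup S T → IsProduct σ
  ∈-prodGroup⇒isProduct {S} {T} σ∈ with a , b , _ , _ , σ≡ab ← ∈-cartesianProductWith⁻ _⊗_ S T σ∈ = a , b , σ≡ab

  module _ {G : List (Perm m)} {H : List (Perm n)} (v : Fin m) (w : Fin n) (g : Perm m) (h : Perm n) where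

    private
      ∈-stabilizer-prodGroup⁻ : ∀ {τ} → τ ∈ stabilizer (prodGroup G H) (combine v w) →
        ∃₂ λ t u → t ∈ stabilizer G v × u ∈ stabilizer H w × τ ≡ t ⊗ u
      ∈-stabilizer-prodGroup⁻ {τ} τ∈ =
        ∈-cartesianProductWith⁻ _⊗_ _ _ (subst (τ ∈_) (stabilizer-prodGroup G H v w) τ∈)

    inStabCoset⇒isProduct : ∀ {σ} → InStabCoset (prodGroup G H) (g ⊗ h) (combine v w) σ → IsProduct σ
    inStabCoset⇒isProduct (τ , τ∈ , refl) with t , u , _ , _ , refl ← ∈-stabilizer-prodGroup⁻ τ∈ =
      g ∘ₚ t , h ∘ₚ u , ⊗-∘ₚ g t h u

    inStabCoset-⊗ : ∀ {a b} → InStabCoset (prodGroup G H) (g ⊗ h) (combine v w) (a ⊗ b) ⇔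
                              (InStabCoset G g v a × InStabCoset H h w b)
    inStabCoset-⊗ {a} {b} = mk⇔ to from
      where
      to : InStabCoset (prodGroup G H) (g ⊗ h) (combine v w) (a ⊗ b) → InStabCoset G g v a × InStabCoset H h w b
      to (τ , τ∈ , ab≡ghτ) with t , u , t∈ , u∈ , refl ← ∈-stabilizer-prodGroup⁻ τ∈
        with refl , refl ← ⊗-injective v w {a} {g ∘ₚ t} {b} {h ∘ₚ u} (trans ab≡ghτ (⊗-∘ₚ g t h u))
        = (t , t∈ , refl) , (u , u∈ , refl)
      from : InStabCoset G g v a × InStabCoset H h w b → InStabCoset (prodGroup G H) (g ⊗ h) (combine v w) (a ⊗ b)
      from ((t , t∈ , refl) , (u , u∈ , refl)) =
        t ⊗ u , subst (t ⊗ u ∈_) (sym (stabilizer-prodGroup G H v w)) (∈-cartesianProductWith⁺ _⊗_ t∈ u∈)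
              , sym (⊗-∘ₚ g t h u)

  isStabCoset-prodGroup⁺ : ∀ {G S : List (Perm m)} {H T : List (Perm n)} →
    IsStabCoset G S → IsStabCoset H T → IsStabCoset (prodGroup G H) (prodGroup S T)
  isStabCoset-prodGroup⁺ {G} {S} {H} {T} (g , g∈G , v , S≐coset) (h , h∈H , w , T≐coset) =
    g ⊗ h , ∈-cartesianProductWith⁺ _⊗_ g∈G h∈H , combine v w ,
    ⇔-on-products (∈-prodGroup⇒isProduct {S} {T}) (inStabCoset⇒isProduct {G} {H} v w g h) λ a b →
      ⇔-trans (⊗-∈-prodGroup v w) (⇔-trans (S≐coset a ×-⇔ T≐coset b) (⇔-sym (inStabCoset-⊗ {G} {H} v w g h)))

  isStabCoset-prodGroup⁻ : ∀ {G S : List (Perm m)} {H T : List (Perm n)} →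
    IsPermGroup G → IsPermGroup H → ∃ (_∈ S) → ∃ (_∈ T) →
    IsStabCoset (prodGroup G H) (prodGroup S T) → IsStabCoset G S × IsStabCoset H T
  isStabCoset-prodGroup⁻ {G} {S} {H} {T} G-group H-group S-inhabited T-inhabited (g₀ , g₀∈ , x , S⊠T≐coset)
    with g , h , g∈G , h∈H , refl ← ∈-cartesianProductWith⁻ _⊗_ G H g₀∈ =
    (g , g∈G , v , ×-⇔-factorˡ pairs T-inhabited (h , inStabCoset-self H-group h w)) ,
    (h , h∈H , w , ×-⇔-factorʳ pairs S-inhabited (g , inStabCoset-self G-group g v))
    where
    v = proj₁ (remQuot {m} n x)
    w = proj₂ (remQuot {m} n x)
    pairs : ∀ (a : Perm m) (b : Perm n) → (a ∈ S × b ∈ T) ⇔ (InStabCoset G g v a × InStabCoset H h w b)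
    pairs a b = ⇔-trans (⇔-sym (⊗-∈-prodGroup v w))
      (⇔-trans (subst (λ x → a ⊗ b ∈ prodGroup S T ⇔ InStabCoset (prodGroup G H) (g ⊗ h) x (a ⊗ b))
                      (sym (combine-remQuot {m} n x)) (S⊠T≐coset (a ⊗ b)))
               (inStabCoset-⊗ {G} {H} v w g h))

module _ {m n : ℕ} {G : List (Perm m)} {H : List (Perm n)}
         (G-group : IsPermGroup G) (H-group : IsPermGroup H) where

  strictEKR-prodGroup⁺ : StrictEKR G → StrictEKR H → StrictEKR (prodGroup G H)
  strictEKR-prodGroup⁺ G-ekr H-ekr = strictEKR⁺ product-coset
    where
    product-coset : ∀ {I} → MaxIntersecting (prodGroup G H) I → IsStabCoset (prodGroup G H) I
    product-coset I-max =
      let S , T , S-max , T-max , I⊆S⊠T , S⊠T⊆I =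
            maxIntersecting-factors G-group H-group (strictEKR-point G-ekr) (strictEKR-point H-ekr) I-max
      in isStabCoset-resp S⊠T⊆I I⊆S⊠T (isStabCoset-prodGroup⁺ (strictEKR⁻ G-ekr S-max) (strictEKR⁻ H-ekr T-max))

  strictEKR-prodGroup⁻ : StrictEKR (prodGroup G H) → StrictEKR G × StrictEKR H
  strictEKR-prodGroup⁻ K-ekr =
    strictEKR⁺ (λ S-max → proj₁ (factor-cosets S-max T₀-max)) ,
    strictEKR⁺ (λ T-max → proj₂ (factor-cosets S₀-max T-max))
    where
    S₀-max = proj₂ (maxIntersecting-attained (IsPermGroup.unique G-group))
    T₀-max = proj₂ (maxIntersecting-attained (IsPermGroup.unique H-group))
    v = proj₁ (remQuot {m} n (strictEKR-point K-ekr))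
    w = proj₂ (remQuot {m} n (strictEKR-point K-ekr))
    factor-cosets : ∀ {S T} → MaxIntersecting G S → MaxIntersecting H T → IsStabCoset G S × IsStabCoset H T
    factor-cosets S-max T-max =
      isStabCoset-prodGroup⁻ G-group H-group
        (maxIntersecting-inhabited G-group v S-max) (maxIntersecting-inhabited H-group w T-max)
        (strictEKR⁻ K-ekr (prodGroup-maxIntersecting G-group H-group v w S-max T-max))

frac-* : ∀ a b c d .{{_ : NonZero c}} .{{_ : NonZero d}} → frac (a * b) (c * d) ≃ frac a c ℚ.* frac b d
frac-* a b (ℕ.suc c) (ℕ.suc d) = *≡* (cong (ℤ._* ℤ.+ (ℕ.suc c * ℕ.suc d)) (pos-* a b))

ρ-prodGroup : ∀ {m n} {G : List (Perm m)} {H : List (Perm n)} → IsPermGroup G → IsPermGroup H →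
              (v : Fin m) (w : Fin n) → ρ (prodGroup G H) (combine v w) ≃ ρ G v ℚ.* ρ H w
ρ-prodGroup {G = G} {H} G-group H-group v w =
  subst (_≃ ρ G v ℚ.* ρ H w) (sym (cong₂ frac (maxIntersecting-prodGroup G-group H-group v w) ∣stabilizer∣≡))
        (frac-* (maxIntersecting G) (maxIntersecting H) (length (stabilizer G v)) (length (stabilizer H w)))
  where
  instance
    _ = stabilizer-nonZero G-group v
    _ = stabilizer-nonZero H-group w
  ∣stabilizer∣≡ : length (stabilizer (prodGroup G H) (combine v w)) ≡
                  length (stabilizer G v) * length (stabilizer H w)
  ∣stabilizer∣≡ = trans (cong length (stabilizer-prodGroup G H v w))
                        (length-cartesianProductWith _⊗_ (stabilizer G v) (stabilizer H w))

theorem3p5 : ∀ {m n : ℕ} (G : List (Perm m)) (H : List (Perm n)) →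
    IsPermGroup G → Transitive G → IsPermGroup H → Transitive H →
    ((v : Fin m) (w : Fin n) → ρ (prodGroup G H) (combine v w) ≃ (ρ G v ℚ.* ρ H w))
    × (StrictEKR (prodGroup G H) ⇔ (StrictEKR G × StrictEKR H))
theorem3p5 G H G-group _ H-group _ =
  ρ-prodGroup G-group H-group ,
  mk⇔ (strictEKR-prodGroup⁻ G-group H-group)
      (λ (G-ekr , H-ekr) → strictEKR-prodGroup⁺ G-group H-group G-ekr H-ekr)
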